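{- Let $s,n\ge1$ and $\alpha,\beta\in\mathcal C(s,n)$. Then $\mathrm{EMC}(\alpha,\beta)=|Y(\alpha)\,\triangle\, Y(\beta)|$, the number of cells lying in exactly one of the two Young diagrams $Y(\alpha),Y(\beta)$ (superimposed inside an $s\times(n-1)$ rectangle with common upper-left cell).
   Context: $\mathcal C(s,n)$ is the set of $n$-tuples $(a_0,\ldots,a_{n-1})$ of nonnegative integers with sum $s$. Earth mover's coefficient of two compositions: for $\alpha,\beta\in\mathcal C(s,n)$ with entries $\alpha(j),\beta(j)$, $j=1,\ldots,n$, $\mathrm{EMC}(\alpha,\beta)$ is the minimum of $\sum_{i,j=1}^n |i-j|\,J(i,j)$ over all $n\times n$ matrices $J$ of nonnegative integers with row sums $\sum_j J(i,j)=\alpha(i)$ and column sums $\sum_i J(i,j)=\beta(j)$. Young diagram of a composition: for $\alpha=(a_0,\ldots,a_{n-1})$, its word $w(\alpha)$ consists of $a_0$ copies of $0$, then $a_1$ copies of $1$, ..., then $a_{n-1}$ copies of $n-1$. $Y(\alpha)$ is the left-justified diagram with $s$ rows whose row lengths, read from bottom to top, are the entries of $w(\alpha)$ (row lengths weakly decreasing top to bottom). $\triangle$ denotes symmetric difference of sets. -}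

module Defs where

open import Data.Nat.Base using (ℕ; zero; suc; _∸_; _*_; _<ᵇ_; ∣_-_∣)
open import Data.Bool.Base using (Bool; true; false; _xor_; if_then_else_)
open import Data.Fin.Base using (Fin; toℕ)
open import Data.List.Base using (List; []; _∷_; map; concat; replicate; allFin; upTo; reverse)
open import Data.Product.Base using (Σ; _×_; _,_)
open import Relation.Binary.PropositionalEquality using (_≡_)
open import Data.Nat.Base using (_≤_)
open import Data.Nat.ListAction using (sum)

Comp : ℕ → Set
Comp n = Fin n → ℕ

total : ∀ {n} → Comp n → ℕ
total {n} α = sum (map α (allFin n))

InC : (s n : ℕ) → Comp n → Set
InC s n α = total α ≡ s

Transport : ∀ {n} → Comp n → Comp n → (Fin n → Fin n → ℕ) → Set
Transport {n} α β J =
  (∀ i → sum (map (λ j → J i j) (allFin n)) ≡ α i) ×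
  (∀ j → sum (map (λ i → J i j) (allFin n)) ≡ β j)

cost : ∀ {n} → (Fin n → Fin n → ℕ) → ℕ
cost {n} J = sum (map (λ i → sum (map (λ j → ∣ toℕ i - toℕ j ∣ * J i j) (allFin n))) (allFin n))

IsEMC : ∀ {n} → Comp n → Comp n → ℕ → Set
IsEMC {n} α β m =
  Σ (Fin n → Fin n → ℕ) (λ J → Transport α β J × cost J ≡ m) ×
  (∀ J → Transport α β J → m ≤ cost J)

word : ∀ {n} → Comp n → List ℕ
word {n} α = concat (map (λ i → replicate (α i) (toℕ i)) (allFin n))

-- row lengths of Y(α) listed from the top row downward
-- (w(α) is read from bottom to top, so reverse it)
rowsTopDown : ∀ {n} → Comp n → List ℕ
rowsTopDown α = reverse (word α)

-- k-th element of a list (0 if out of range; never happens for k < s)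
nth : List ℕ → ℕ → ℕ
nth []       _       = 0
nth (x ∷ xs) zero    = x
nth (x ∷ xs) (suc k) = nth xs k

-- cell (r , c) (row r from the top, column c from the left, 0-indexed)
-- lies in the left-justified diagram Y(α)
inY : ∀ {n} → Comp n → ℕ → ℕ → Bool
inY α r c = c <ᵇ nth (rowsTopDown α) r

symDiffSize : (s n : ℕ) → Comp n → Comp n → ℕ
symDiffSize s n α β =
  sum (map (λ r → sum (map (λ c → if inY α r c xor inY β r c then 1 else 0)
                           (upTo (n ∸ 1))))
           (upTo s))

-- Read from the top, the rows of Y(α) have the lengths a₀ ≥ a₁ ≥ … of w(α) in decreasing
-- order, so row k contributes ∣aₖ − bₖ∣ cells to Y(α) △ Y(β): the symmetric difference is the
-- cost Σₖ ∣aₖ − bₖ∣ of matching the two sorted words entry by entry, and pairing aₖ with bₖ is a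
-- transport plan of exactly that cost.  Conversely, a transport plan J is a list of pairs whose
-- first coordinates form w(α) and whose second coordinates are a rearrangement of w(β).  As
-- ∣x − y∣ satisfies the Monge inequality, uncrossing two pairs never increases the cost, so
-- insertion-sorting the second coordinates brings the cost of J down to Σₖ ∣aₖ − bₖ∣.

module Submission where

open import Defs
open import Data.Nat.Base
import Data.Nat.Base as ℕ
open import Data.Nat.Properties
open import Data.Nat.ListAction using (sum)
open import Data.Nat.ListAction.Properties using (sum-++; sum-↭)
open import Data.Bool.Base using (Bool; true; false; T; _xor_; if_then_else_)
open import Data.Fin.Base using (Fin; toℕ; zero; suc)
open import Data.List.Base
  using (List; []; _∷_; _++_; map; concat; concatMap; replicate; zipWith; zip; reverse; _ʳ++_; length;
         allFin; upTo)
open import Data.List.Properties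
  using (map-cong; map-cong-local; map-∘; map-++; map-tabulate; map-applyUpTo; map-replicate; map-concatMap;
         ++-assoc; length-++; length-map; length-replicate; length-reverse)
open import Data.List.Relation.Unary.All as All using (All; []; _∷_)
import Data.List.Relation.Unary.All.Properties as All
open import Data.List.Relation.Unary.Linked as Linked using (Linked; []; [-]; _∷_)
import Data.List.Relation.Unary.Linked.Properties as Linked
open import Data.List.Relation.Binary.Permutation.Propositional
  using (_↭_; ↭-refl; ↭-sym; ↭-trans; ↭-reflexive; ↭⇒↭ₛ; module PermutationReasoning)
open import Data.List.Relation.Binary.Permutation.Propositional.Properties
  using (All-resp-↭; ↭-reverse; ↭-length; ++⁺ˡ; shifts)
open import Data.List.Relation.Binary.Pointwise using (Pointwise-≡⇒≡)
open import Data.List.Relation.Unary.Sorted.TotalOrder.Properties using (↗↭↗⇒≋)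
open import Data.List.Sort.InsertionSort.Base ≤-decTotalOrder using (insert; sort)
open import Data.List.Sort.InsertionSort.Properties ≤-decTotalOrder using (sort-↭; sort-↗)
open import Data.Product.Base using (Σ; _×_; _,_; proj₁; proj₂; uncurry)
open import Data.Sum.Base using (inj₁; inj₂)
open import Function.Base using (_∘_; id)
open import Relation.Binary.PropositionalEquality
open import Algebra.Properties.CommutativeSemigroup +-commutativeSemigroup using (interchange; x∙yz≈xz∙y)

private
  variable
    A B C : Set

𝟙 : Bool → ℕ
𝟙 b = if b then 1 else 0

sum-map-cong : ∀ {f g : A → ℕ} → (∀ x → f x ≡ g x) → ∀ xs → sum (map f xs) ≡ sum (map g xs)
sum-map-cong f≗g xs = cong sum (map-cong f≗g xs)

sum-map-cong-local : ∀ {f g : A → ℕ} {xs} → All (λ x → f x ≡ g x) xs → sum (map f xs) ≡ sum (map g xs)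
sum-map-cong-local f≡g = cong sum (map-cong-local f≡g)

sum-map-zero : ∀ {f : A → ℕ} → (∀ x → f x ≡ 0) → ∀ xs → sum (map f xs) ≡ 0
sum-map-zero f≗0 []       = refl
sum-map-zero f≗0 (x ∷ xs) = cong₂ _+_ (f≗0 x) (sum-map-zero f≗0 xs)

sum-map-+ : ∀ (f g : A → ℕ) xs → sum (map (λ x → f x + g x) xs) ≡ sum (map f xs) + sum (map g xs)
sum-map-+ f g []       = refl
sum-map-+ f g (x ∷ xs) = trans (cong (f x + g x +_) (sum-map-+ f g xs)) (interchange (f x) (g x) _ _)

sum-map-*ˡ : ∀ c (f : A → ℕ) xs → sum (map (λ x → c * f x) xs) ≡ c * sum (map f xs)
sum-map-*ˡ c f []       = sym (*-zeroʳ c)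
sum-map-*ˡ c f (x ∷ xs) = trans (cong (c * f x +_) (sum-map-*ˡ c f xs)) (sym (*-distribˡ-+ c (f x) _))

sum-map-comm : ∀ (f : A → B → ℕ) xs ys →
  sum (map (λ x → sum (map (f x) ys)) xs) ≡ sum (map (λ y → sum (map (λ x → f x y) xs)) ys)
sum-map-comm f []       ys = sym (sum-map-zero (λ _ → refl) ys)
sum-map-comm f (x ∷ xs) ys =
  trans (cong (sum (map (f x) ys) +_) (sum-map-comm f xs ys)) (sym (sum-map-+ (f x) _ ys))

sum-map-concatMap : ∀ (f : B → ℕ) (g : A → List B) xs →
  sum (map f (concatMap g xs)) ≡ sum (map (λ x → sum (map f (g x))) xs)
sum-map-concatMap f g []       = refl
sum-map-concatMap f g (x ∷ xs) = begin
  sum (map f (g x ++ concatMap g xs))             ≡⟨ cong sum (map-++ f (g x) _) ⟩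
  sum (map f (g x) ++ map f (concatMap g xs))     ≡⟨ sum-++ (map f (g x)) _ ⟩
  sum (map f (g x)) + sum (map f (concatMap g xs)) ≡⟨ cong (_ +_) (sum-map-concatMap f g xs) ⟩
  sum (map f (g x)) + sum (map (λ x → sum (map f (g x))) xs) ∎
  where open ≡-Reasoning

sum-map-replicate : ∀ (f : A → ℕ) k x → sum (map f (replicate k x)) ≡ k * f x
sum-map-replicate f zero    x = refl
sum-map-replicate f (suc k) x = cong (f x +_) (sum-map-replicate f k x)

map-allFin-suc : ∀ {n} (f : Fin (suc n) → A) → map f (allFin (suc n)) ≡ f zero ∷ map (f ∘ suc) (allFin n)
map-allFin-suc f = cong (f zero ∷_) (trans (map-tabulate suc f) (sym (map-tabulate id (f ∘ suc))))

map-upTo-suc : ∀ n (f : ℕ → A) → map f (upTo (suc n)) ≡ f 0 ∷ map (f ∘ suc) (upTo n)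
map-upTo-suc n f = cong (f 0 ∷_) (trans (map-applyUpTo suc f n) (sym (map-applyUpTo id (f ∘ suc) n)))

sum-allFin-δ : ∀ {n} (g : ℕ → ℕ) {y} → y < n →
  sum (map (λ (j : Fin n) → g (toℕ j) * 𝟙 (toℕ j ≡ᵇ y)) (allFin n)) ≡ g y
sum-allFin-δ {suc n} g {zero} _ = begin
  sum (map (λ j → g (toℕ j) * 𝟙 (toℕ j ≡ᵇ 0)) (allFin (suc n)))
    ≡⟨ cong sum (map-allFin-suc {n = n} (λ j → g (toℕ j) * 𝟙 (toℕ j ≡ᵇ 0))) ⟩
  g 0 * 1 + sum (map (λ j → g (suc (toℕ j)) * 0) (allFin n))
    ≡⟨ cong₂ _+_ (*-identityʳ (g 0)) (sum-map-zero (λ j → *-zeroʳ (g (suc (toℕ j)))) (allFin n)) ⟩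
  g 0 + 0
    ≡⟨ +-identityʳ (g 0) ⟩
  g 0 ∎
  where open ≡-Reasoning
sum-allFin-δ {suc n} g {suc y} (s≤s y<n) =
  trans (cong sum (map-allFin-suc {n = n} (λ j → g (toℕ j) * 𝟙 (toℕ j ≡ᵇ suc y))))
        (cong₂ _+_ (*-zeroʳ (g 0)) (sum-allFin-δ (g ∘ suc) y<n))

multiplicity : ℕ → List ℕ → ℕ
multiplicity a xs = sum (map (λ x → 𝟙 (a ≡ᵇ x)) xs)

multiplicity-++ : ∀ a xs ys → multiplicity a (xs ++ ys) ≡ multiplicity a xs + multiplicity a ys
multiplicity-++ a xs ys = trans (cong sum (map-++ _ xs ys)) (sum-++ (map _ xs) _)

multiplicity-map-suc : ∀ a xs → multiplicity (suc a) (map suc xs) ≡ multiplicity a xs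
multiplicity-map-suc a xs = cong sum (sym (map-∘ xs))

multiplicity-zero-map-suc : ∀ xs → multiplicity 0 (map suc xs) ≡ 0
multiplicity-zero-map-suc xs = trans (cong sum (sym (map-∘ xs))) (sum-map-zero (λ _ → refl) xs)

total-suc : ∀ {n} (α : Comp (suc n)) → total α ≡ α zero + total (α ∘ suc)
total-suc α = cong sum (map-allFin-suc α)

word-suc : ∀ {n} (α : Comp (suc n)) → word α ≡ replicate (α zero) 0 ++ map suc (word (α ∘ suc))
word-suc {n} α = begin
  concatMap block (allFin (suc n))
    ≡⟨ cong concat (map-allFin-suc block) ⟩
  replicate (α zero) 0 ++ concatMap (block ∘ suc) (allFin n)
    ≡⟨ cong (replicate (α zero) 0 ++_) (cong concat (map-cong shift (allFin n))) ⟩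
  replicate (α zero) 0 ++ concatMap (map suc ∘ tailBlock) (allFin n)
    ≡⟨ cong (replicate (α zero) 0 ++_) (sym (map-concatMap suc tailBlock (allFin n))) ⟩
  replicate (α zero) 0 ++ map suc (word (α ∘ suc)) ∎
  where
  open ≡-Reasoning
  block : Fin (suc n) → List ℕ
  block i = replicate (α i) (toℕ i)
  tailBlock : Fin n → List ℕ
  tailBlock i = replicate (α (suc i)) (toℕ i)
  shift : ∀ i → block (suc i) ≡ map suc (tailBlock i)
  shift i = sym (map-replicate suc (α (suc i)) (toℕ i))

length-word : ∀ {n} (α : Comp n) → length (word α) ≡ total α
length-word {zero}  α = refl
length-word {suc n} α = begin
  length (word α)                                    ≡⟨ cong length (word-suc α) ⟩
  length (replicate (α zero) 0 ++ map suc w)          ≡⟨ length-++ (replicate (α zero) 0) ⟩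
  length (replicate (α zero) 0) + length (map suc w)
    ≡⟨ cong₂ _+_ (length-replicate (α zero)) (trans (length-map ℕ.suc w) (length-word (α ∘ suc))) ⟩
  α zero + total (α ∘ suc)                           ≡⟨ total-suc α ⟨
  total α                                            ∎
  where
  open ≡-Reasoning
  w = word (α ∘ suc)

length-word-≡ : ∀ {n} (α β : Comp n) → total α ≡ total β → length (word α) ≡ length (word β)
length-word-≡ α β total≡ = trans (length-word α) (trans total≡ (sym (length-word β)))

word-< : ∀ {n} (α : Comp n) → All (_< n) (word α)
word-< {zero}  α = []
word-< {suc n} α = subst (All (_< suc n)) (sym (word-suc α))
  (All.++⁺ (All.replicate⁺ (α zero) z<s) (All.map⁺ (All.map s<s (word-< (α ∘ suc)))))

zeros-++-sorted : ∀ k {xs} → Linked _≤_ xs → Linked _≤_ (replicate k 0 ++ xs)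
zeros-++-sorted zero    sorted = sorted
zeros-++-sorted (suc k) sorted = zero∷ (zeros-++-sorted k sorted)
  where
  zero∷ : ∀ {ys} → Linked _≤_ ys → Linked _≤_ (0 ∷ ys)
  zero∷ {[]}    _ = [-]
  zero∷ {_ ∷ _} p = z≤n ∷ p

word-sorted : ∀ {n} (α : Comp n) → Linked _≤_ (word α)
word-sorted {zero}  α = []
word-sorted {suc n} α = subst (Linked _≤_) (sym (word-suc α))
  (zeros-++-sorted (α zero) (Linked.map⁺ (Linked.map s≤s (word-sorted (α ∘ suc)))))

multiplicity-word : ∀ {n} (α : Comp n) i → multiplicity (toℕ i) (word α) ≡ α i
multiplicity-word {suc n} α i = trans (cong (multiplicity (toℕ i)) (word-suc α))
  (trans (multiplicity-++ (toℕ i) (replicate (α zero) 0) _) (split i))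
  where
  w = word (α ∘ suc)
  split : ∀ i → multiplicity (toℕ i) (replicate (α zero) 0) + multiplicity (toℕ i) (map suc w) ≡ α i
  split zero    = trans (cong₂ _+_ (trans (sum-map-replicate _ (α zero) 0) (*-identityʳ (α zero)))
                                  (multiplicity-zero-map-suc w))
                        (+-identityʳ (α zero))
  split (suc i) = cong₂ _+_ (trans (sum-map-replicate _ (α zero) 0) (*-zeroʳ (α zero)))
                            (trans (multiplicity-map-suc (toℕ i) w) (multiplicity-word (α ∘ suc) i))

count-xor-<ᵇ : ∀ m {a b} → a ≤ m → b ≤ m →
  sum (map (λ c → 𝟙 ((c <ᵇ a) xor (c <ᵇ b))) (upTo m)) ≡ ∣ a - b ∣
count-xor-<ᵇ zero    z≤n z≤n = refl
count-xor-<ᵇ (suc m) {a} {b} a≤ b≤ =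
  trans (cong sum (map-upTo-suc m (λ c → 𝟙 ((c <ᵇ a) xor (c <ᵇ b))))) (step a≤ b≤)
  where
  step : ∀ {a b} → a ≤ suc m → b ≤ suc m →
    𝟙 ((0 <ᵇ a) xor (0 <ᵇ b)) + sum (map (λ c → 𝟙 ((suc c <ᵇ a) xor (suc c <ᵇ b))) (upTo m)) ≡ ∣ a - b ∣
  step {zero}  {zero}  _         _         = sum-map-zero (λ _ → refl) (upTo m)
  step {zero}  {suc b} _         (s≤s b≤) = cong suc (count-xor-<ᵇ m z≤n b≤)
  step {suc a} {zero}  (s≤s a≤) _         = cong suc (trans (count-xor-<ᵇ m a≤ z≤n) (∣-∣-identityʳ a))
  step {suc a} {suc b} (s≤s a≤) (s≤s b≤) = count-xor-<ᵇ m a≤ b≤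

nth-≤ : ∀ {m xs} → All (_≤ m) xs → ∀ r → nth xs r ≤ m
nth-≤ []       r       = z≤n
nth-≤ (p ∷ ps) zero    = p
nth-≤ (p ∷ ps) (suc r) = nth-≤ ps r

rowsTopDown-≤ : ∀ {n} (α : Comp n) r → nth (rowsTopDown α) r ≤ n ∸ 1
rowsTopDown-≤ α = nth-≤ (All-resp-↭ (↭-sym (↭-reverse (word α))) (All.map <⇒≤pred (word-< α)))

sum-upTo-nth : ∀ (f : ℕ → ℕ → ℕ) s xs ys → length xs ≡ s → length ys ≡ s →
  sum (map (λ r → f (nth xs r) (nth ys r)) (upTo s)) ≡ sum (zipWith f xs ys)
sum-upTo-nth f zero    []       []       _   _   = refl
sum-upTo-nth f (suc s) (x ∷ xs) (y ∷ ys) ∣xs∣ ∣ys∣ =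
  trans (cong sum (map-upTo-suc s (λ r → f (nth (x ∷ xs) r) (nth (y ∷ ys) r))))
        (cong (f x y +_) (sum-upTo-nth f s xs ys (suc-injective ∣xs∣) (suc-injective ∣ys∣)))

zipWith-ʳ++ : ∀ (f : A → B → C) xs ys as bs → length xs ≡ length ys →
  zipWith f (xs ʳ++ as) (ys ʳ++ bs) ≡ zipWith f xs ys ʳ++ zipWith f as bs
zipWith-ʳ++ f []       []       as bs _  = refl
zipWith-ʳ++ f (x ∷ xs) (y ∷ ys) as bs eq = zipWith-ʳ++ f xs ys (x ∷ as) (y ∷ bs) (suc-injective eq)

sum-zipWith-reverse : ∀ (f : ℕ → ℕ → ℕ) xs ys → length xs ≡ length ys →
  sum (zipWith f (reverse xs) (reverse ys)) ≡ sum (zipWith f xs ys)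
sum-zipWith-reverse f xs ys eq =
  trans (cong sum (zipWith-ʳ++ f xs ys [] [] eq)) (sum-↭ (↭-reverse (zipWith f xs ys)))

matchingCost : List ℕ → List ℕ → ℕ
matchingCost xs ys = sum (zipWith ∣_-_∣ xs ys)

symDiffSize≡matchingCost : ∀ {s n} (α β : Comp n) → InC s n α → InC s n β →
  symDiffSize s n α β ≡ matchingCost (word α) (word β)
symDiffSize≡matchingCost {s} {n} α β α∈C β∈C = begin
  symDiffSize s n α β
    ≡⟨ sum-map-cong (λ r → count-xor-<ᵇ (n ∸ 1) (rowsTopDown-≤ α r) (rowsTopDown-≤ β r)) (upTo s) ⟩
  sum (map (λ r → ∣ nth (rowsTopDown α) r - nth (rowsTopDown β) r ∣) (upTo s))
    ≡⟨ sum-upTo-nth ∣_-_∣ s (rowsTopDown α) (rowsTopDown β) (length-rows α α∈C) (length-rows β β∈C) ⟩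
  matchingCost (reverse (word α)) (reverse (word β))
    ≡⟨ sum-zipWith-reverse ∣_-_∣ (word α) (word β) (length-word-≡ α β (trans α∈C (sym β∈C))) ⟩
  matchingCost (word α) (word β) ∎
  where
  open ≡-Reasoning
  length-rows : ∀ γ → InC s n γ → length (rowsTopDown γ) ≡ s
  length-rows γ γ∈C = trans (length-reverse (word γ)) (trans (length-word γ) γ∈C)

dist : ℕ × ℕ → ℕ
dist = uncurry ∣_-_∣

sum-dist≡matchingCost : ∀ Z → sum (map dist Z) ≡ matchingCost (map proj₁ Z) (map proj₂ Z)
sum-dist≡matchingCost []      = refl
sum-dist≡matchingCost (z ∷ Z) = cong (dist z +_) (sum-dist≡matchingCost Z)

pairCount : ∀ {n} → List (ℕ × ℕ) → Fin n → Fin n → ℕ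
pairCount Z i j = sum (map (λ z → 𝟙 (toℕ i ≡ᵇ proj₁ z) * 𝟙 (toℕ j ≡ᵇ proj₂ z)) Z)

rowSum-pairCount : ∀ {n} Z → All (_< n) (map proj₂ Z) → ∀ (i : Fin n) →
  sum (map (pairCount Z i) (allFin n)) ≡ multiplicity (toℕ i) (map proj₁ Z)
rowSum-pairCount {n} Z bounded i = begin
  sum (map (pairCount Z i) (allFin n))
    ≡⟨ sum-map-comm (λ j z → 𝟙 (toℕ i ≡ᵇ proj₁ z) * 𝟙 (toℕ j ≡ᵇ proj₂ z)) (allFin n) Z ⟩
  sum (map (λ z → sum (map (λ j → 𝟙 (toℕ i ≡ᵇ proj₁ z) * 𝟙 (toℕ j ≡ᵇ proj₂ z)) (allFin n))) Z)
    ≡⟨ sum-map-cong-local (All.map (λ {z} → sum-allFin-δ (λ _ → 𝟙 (toℕ i ≡ᵇ proj₁ z))) (All.map⁻ bounded)) ⟩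
  sum (map (λ z → 𝟙 (toℕ i ≡ᵇ proj₁ z)) Z)
    ≡⟨ cong sum (map-∘ Z) ⟩
  multiplicity (toℕ i) (map proj₁ Z) ∎
  where open ≡-Reasoning

colSum-pairCount : ∀ {n} Z → All (_< n) (map proj₁ Z) → ∀ (j : Fin n) →
  sum (map (λ i → pairCount Z i j) (allFin n)) ≡ multiplicity (toℕ j) (map proj₂ Z)
colSum-pairCount {n} Z bounded j = begin
  sum (map (λ i → pairCount Z i j) (allFin n))
    ≡⟨ sum-map-comm (λ i z → 𝟙 (toℕ i ≡ᵇ proj₁ z) * 𝟙 (toℕ j ≡ᵇ proj₂ z)) (allFin n) Z ⟩
  sum (map (λ z → sum (map (λ i → 𝟙 (toℕ i ≡ᵇ proj₁ z) * 𝟙 (toℕ j ≡ᵇ proj₂ z)) (allFin n))) Z)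
    ≡⟨ sum-map-cong-local (All.map column (All.map⁻ bounded)) ⟩
  sum (map (λ z → 𝟙 (toℕ j ≡ᵇ proj₂ z)) Z)
    ≡⟨ cong sum (map-∘ Z) ⟩
  multiplicity (toℕ j) (map proj₂ Z) ∎
  where
  open ≡-Reasoning
  column : ∀ {z} → proj₁ z < n →
    sum (map (λ i → 𝟙 (toℕ i ≡ᵇ proj₁ z) * 𝟙 (toℕ j ≡ᵇ proj₂ z)) (allFin n)) ≡ 𝟙 (toℕ j ≡ᵇ proj₂ z)
  column {z} x<n = trans (sum-map-cong (λ i → *-comm (𝟙 (toℕ i ≡ᵇ proj₁ z)) _) (allFin n))
                         (sum-allFin-δ (λ _ → 𝟙 (toℕ j ≡ᵇ proj₂ z)) x<n)

cost-pairCount : ∀ {n} Z → All (_< n) (map proj₁ Z) → All (_< n) (map proj₂ Z) →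
  cost (pairCount {n} Z) ≡ sum (map dist Z)
cost-pairCount {n} Z bounded₁ bounded₂ = begin
  sum (map (λ i → sum (map (λ j → d i j * pairCount Z i j) (allFin n))) (allFin n))
    ≡⟨ sum-map-cong (λ i → sum-map-cong (λ j → sym (sum-map-*ˡ (d i j) (e i j) Z)) (allFin n)) (allFin n) ⟩
  sum (map (λ i → sum (map (λ j → sum (map (λ z → d i j * e i j z) Z)) (allFin n))) (allFin n))
    ≡⟨ sum-map-cong (λ i → sum-map-comm (λ j z → d i j * e i j z) (allFin n) Z) (allFin n) ⟩
  sum (map (λ i → sum (map (λ z → sum (map (λ j → d i j * e i j z) (allFin n))) Z)) (allFin n))
    ≡⟨ sum-map-comm (λ i z → sum (map (λ j → d i j * e i j z) (allFin n))) (allFin n) Z ⟩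
  sum (map (λ z → sum (map (λ i → sum (map (λ j → d i j * e i j z) (allFin n))) (allFin n))) Z)
    ≡⟨ sum-map-cong-local (All.map pointMass (All.zip (All.map⁻ bounded₁ , All.map⁻ bounded₂))) ⟩
  sum (map dist Z) ∎
  where
  open ≡-Reasoning
  d : Fin n → Fin n → ℕ
  d i j = ∣ toℕ i - toℕ j ∣
  e : Fin n → Fin n → ℕ × ℕ → ℕ
  e i j z = 𝟙 (toℕ i ≡ᵇ proj₁ z) * 𝟙 (toℕ j ≡ᵇ proj₂ z)
  pointMass : ∀ {z} → proj₁ z < n × proj₂ z < n →
    sum (map (λ i → sum (map (λ j → d i j * e i j z) (allFin n))) (allFin n)) ≡ dist z
  pointMass {x , y} (x<n , y<n) = begin
    sum (map (λ i → sum (map (λ j → d i j * e i j (x , y)) (allFin n))) (allFin n))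
      ≡⟨ sum-map-cong (λ i → sum-map-cong (λ j → sym (*-assoc (d i j) _ _)) (allFin n)) (allFin n) ⟩
    sum (map (λ i → sum (map (λ j → (d i j * 𝟙 (toℕ i ≡ᵇ x)) * 𝟙 (toℕ j ≡ᵇ y)) (allFin n))) (allFin n))
      ≡⟨ sum-map-cong (λ i → sum-allFin-δ (λ k → ∣ toℕ i - k ∣ * 𝟙 (toℕ i ≡ᵇ x)) y<n) (allFin n) ⟩
    sum (map (λ i → ∣ toℕ i - y ∣ * 𝟙 (toℕ i ≡ᵇ x)) (allFin n))
      ≡⟨ sum-allFin-δ (λ k → ∣ k - y ∣) x<n ⟩
    ∣ x - y ∣ ∎

map-proj₁-zip : ∀ (xs : List A) (ys : List B) → length xs ≡ length ys → map proj₁ (zip xs ys) ≡ xs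
map-proj₁-zip []       []       _  = refl
map-proj₁-zip (x ∷ xs) (y ∷ ys) eq = cong (x ∷_) (map-proj₁-zip xs ys (suc-injective eq))

map-proj₂-zip : ∀ (xs : List A) (ys : List B) → length xs ≡ length ys → map proj₂ (zip xs ys) ≡ ys
map-proj₂-zip []       []       _  = refl
map-proj₂-zip (x ∷ xs) (y ∷ ys) eq = cong (y ∷_) (map-proj₂-zip xs ys (suc-injective eq))

sortedPlan : ∀ {n} (α β : Comp n) → total α ≡ total β →
  Σ (Fin n → Fin n → ℕ) (λ J → Transport α β J × cost J ≡ matchingCost (word α) (word β))
sortedPlan {n} α β total≡ = pairCount {n} Z , (rowSums , colSums) , costZ
  where
  Z = zip (word α) (word β)
  length≡ : length (word α) ≡ length (word β)
  length≡ = length-word-≡ α β total≡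
  fst≡ : map proj₁ Z ≡ word α
  fst≡ = map-proj₁-zip (word α) (word β) length≡
  snd≡ : map proj₂ Z ≡ word β
  snd≡ = map-proj₂-zip (word α) (word β) length≡
  bounded₁ : All (_< n) (map proj₁ Z)
  bounded₁ = subst (All (_< n)) (sym fst≡) (word-< α)
  bounded₂ : All (_< n) (map proj₂ Z)
  bounded₂ = subst (All (_< n)) (sym snd≡) (word-< β)
  rowSums : ∀ i → sum (map (pairCount Z i) (allFin n)) ≡ α i
  rowSums i = trans (rowSum-pairCount Z bounded₂ i)
                    (trans (cong (multiplicity (toℕ i)) fst≡) (multiplicity-word α i))
  colSums : ∀ j → sum (map (λ i → pairCount Z i j) (allFin n)) ≡ β j
  colSums j = trans (colSum-pairCount Z bounded₁ j)
                    (trans (cong (multiplicity (toℕ j)) snd≡) (multiplicity-word β j))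
  costZ : cost (pairCount {n} Z) ≡ matchingCost (word α) (word β)
  costZ = trans (cost-pairCount Z bounded₁ bounded₂)
                (trans (sum-dist≡matchingCost Z) (cong₂ matchingCost fst≡ snd≡))

∣-∣-between : ∀ {x w y} → x ≤ w → w ≤ y → ∣ x - w ∣ + ∣ w - y ∣ ≡ ∣ x - y ∣
∣-∣-between {y = y}   z≤n       z≤n       = refl
∣-∣-between {zero}    z≤n       (s≤s w≤y) = cong suc (∣-∣-between {zero} z≤n w≤y)
∣-∣-between           (s≤s x≤w) (s≤s w≤y) = ∣-∣-between x≤w w≤y

∣-∣-monge-between : ∀ {x x′ w y} → x ≤ w → w ≤ y → ∣ x - w ∣ + ∣ x′ - y ∣ ≤ ∣ x - y ∣ + ∣ x′ - w ∣
∣-∣-monge-between {x} {x′} {w} {y} x≤w w≤y = begin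
  ∣ x - w ∣ + ∣ x′ - y ∣                 ≤⟨ +-monoʳ-≤ ∣ x - w ∣ (∣-∣-triangle x′ w y) ⟩
  ∣ x - w ∣ + (∣ x′ - w ∣ + ∣ w - y ∣)   ≡⟨ x∙yz≈xz∙y ∣ x - w ∣ ∣ x′ - w ∣ ∣ w - y ∣ ⟩
  (∣ x - w ∣ + ∣ w - y ∣) + ∣ x′ - w ∣   ≡⟨ cong (_+ ∣ x′ - w ∣) (∣-∣-between x≤w w≤y) ⟩
  ∣ x - y ∣ + ∣ x′ - w ∣                 ∎
  where open ≤-Reasoning

-- Either x ≤ w ≤ y, or w ≤ x ≤ x′, which is the same situation after swapping (x , x′) with (w , y).
∣-∣-monge : ∀ {x x′ w y} → x ≤ x′ → w ≤ y → ∣ x - w ∣ + ∣ x′ - y ∣ ≤ ∣ x - y ∣ + ∣ x′ - w ∣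
∣-∣-monge {x} {x′} {w} {y} x≤x′ w≤y with ≤-total x w
... | inj₁ x≤w = ∣-∣-monge-between {x′ = x′} x≤w w≤y
... | inj₂ w≤x = subst₂ _≤_ (cong₂ _+_ (∣-∣-comm w x) (∣-∣-comm y x′))
                           (trans (cong₂ _+_ (∣-∣-comm w x′) (∣-∣-comm y x)) (+-comm ∣ x′ - w ∣ ∣ x - y ∣))
                           (∣-∣-monge-between {x′ = y} w≤x x≤x′)

matchingCost-insert : ∀ {x xs} y ws → Linked _≤_ (x ∷ xs) → length xs ≡ length ws →
  matchingCost (x ∷ xs) (insert y ws) ≤ ∣ x - y ∣ + matchingCost xs ws
matchingCost-insert {x} {[]}      y []       _              _  = ≤-refl
matchingCost-insert {x} {x′ ∷ xs} y (w ∷ ws) (x≤x′ ∷ sorted) eq with y ≤ᵇ w in y≤ᵇw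
... | true  = ≤-refl
... | false = begin
  ∣ x - w ∣ + matchingCost (x′ ∷ xs) (insert y ws)
    ≤⟨ +-monoʳ-≤ ∣ x - w ∣ (matchingCost-insert y ws sorted (suc-injective eq)) ⟩
  ∣ x - w ∣ + (∣ x′ - y ∣ + matchingCost xs ws)
    ≡⟨ +-assoc ∣ x - w ∣ _ _ ⟨
  (∣ x - w ∣ + ∣ x′ - y ∣) + matchingCost xs ws
    ≤⟨ +-monoˡ-≤ (matchingCost xs ws) (∣-∣-monge x≤x′ (≰⇒≥ (λ y≤w → subst T y≤ᵇw (≤⇒≤ᵇ y≤w)))) ⟩
  (∣ x - y ∣ + ∣ x′ - w ∣) + matchingCost xs ws
    ≡⟨ +-assoc ∣ x - y ∣ _ _ ⟩
  ∣ x - y ∣ + (∣ x′ - w ∣ + matchingCost xs ws) ∎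
  where open ≤-Reasoning

matchingCost-sort : ∀ {xs} zs → Linked _≤_ xs → length xs ≡ length zs →
  matchingCost xs (sort zs) ≤ matchingCost xs zs
matchingCost-sort {[]}     []       _      _  = ≤-refl
matchingCost-sort {x ∷ xs} (z ∷ zs) sorted eq = ≤-trans
  (matchingCost-insert z (sort zs) sorted (trans (suc-injective eq) (sym (↭-length (sort-↭ zs)))))
  (+-monoʳ-≤ ∣ x - z ∣ (matchingCost-sort zs (Linked.tail sorted) (suc-injective eq)))

concatMap-const-[] : ∀ (xs : List A) → concatMap (λ _ → []) xs ≡ ([] {A = B})
concatMap-const-[] []       = refl
concatMap-const-[] (x ∷ xs) = concatMap-const-[] xs

concatMap-++-↭ : ∀ (f g : A → List B) xs →
  concatMap f xs ++ concatMap g xs ↭ concatMap (λ x → f x ++ g x) xs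
concatMap-++-↭ f g []       = ↭-refl
concatMap-++-↭ f g (x ∷ xs) = begin
  (f x ++ F) ++ (g x ++ G)   ≡⟨ ++-assoc (f x) F _ ⟩
  f x ++ (F ++ (g x ++ G))   ↭⟨ ++⁺ˡ (f x) (shifts F (g x)) ⟩
  f x ++ (g x ++ (F ++ G))   ↭⟨ ++⁺ˡ (f x) (++⁺ˡ (g x) (concatMap-++-↭ f g xs)) ⟩
  f x ++ (g x ++ FG)         ≡⟨ ++-assoc (f x) (g x) FG ⟨
  (f x ++ g x) ++ FG         ∎
  where
  open PermutationReasoning
  F  = concatMap f xs
  G  = concatMap g xs
  FG = concatMap (λ x → f x ++ g x) xs

concatMap-comm-↭ : ∀ (f : A → B → List C) xs ys →
  concatMap (λ x → concatMap (f x) ys) xs ↭ concatMap (λ y → concatMap (λ x → f x y) xs) ys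
concatMap-comm-↭ f []       ys = ↭-reflexive (sym (concatMap-const-[] ys))
concatMap-comm-↭ f (x ∷ xs) ys = begin
  concatMap (f x) ys ++ concatMap (λ x → concatMap (f x) ys) xs
    ↭⟨ ++⁺ˡ (concatMap (f x) ys) (concatMap-comm-↭ f xs ys) ⟩
  concatMap (f x) ys ++ concatMap (λ y → concatMap (λ x → f x y) xs) ys
    ↭⟨ concatMap-++-↭ (f x) _ ys ⟩
  concatMap (λ y → f x y ++ concatMap (λ x → f x y) xs) ys ∎
  where open PermutationReasoning

replicate-+ : ∀ m n (b : A) → replicate (m + n) b ≡ replicate m b ++ replicate n b
replicate-+ zero    n b = refl
replicate-+ (suc m) n b = cong (b ∷_) (replicate-+ m n b)

concatMap-replicate : ∀ (k : A → ℕ) (b : B) xs →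
  concatMap (λ x → replicate (k x) b) xs ≡ replicate (sum (map k xs)) b
concatMap-replicate k b []       = refl
concatMap-replicate k b (x ∷ xs) =
  trans (cong (replicate (k x) b ++_) (concatMap-replicate k b xs)) (sym (replicate-+ (k x) _ b))

planPairs : ∀ {n} → (Fin n → Fin n → ℕ) → List (ℕ × ℕ)
planPairs {n} J = concatMap (λ i → concatMap (λ j → replicate (J i j) (toℕ i , toℕ j)) (allFin n)) (allFin n)

sum-dist-planPairs : ∀ {n} (J : Fin n → Fin n → ℕ) → sum (map dist (planPairs J)) ≡ cost J
sum-dist-planPairs {n} J = trans (sum-map-concatMap dist _ (allFin n)) (sum-map-cong row (allFin n))
  where
  row : ∀ i → sum (map dist (concatMap (λ j → replicate (J i j) (toℕ i , toℕ j)) (allFin n)))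
            ≡ sum (map (λ j → ∣ toℕ i - toℕ j ∣ * J i j) (allFin n))
  row i = trans (sum-map-concatMap dist _ (allFin n))
                (sum-map-cong (λ j → trans (sum-map-replicate dist (J i j) _) (*-comm (J i j) _)) (allFin n))

map-planPairs : ∀ {n} (J : Fin n → Fin n → ℕ) (π : ℕ × ℕ → A) →
  map π (planPairs J)
    ≡ concatMap (λ i → concatMap (λ j → replicate (J i j) (π (toℕ i , toℕ j))) (allFin n)) (allFin n)
map-planPairs {n = n} J π = trans (map-concatMap π _ (allFin n))
  (cong concat (map-cong (λ i → trans (map-concatMap π _ (allFin n))
    (cong concat (map-cong (λ j → map-replicate π (J i j) _) (allFin n)))) (allFin n)))

map-proj₁-planPairs : ∀ {n} {α β : Comp n} J → Transport α β J → map proj₁ (planPairs J) ≡ word α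
map-proj₁-planPairs {n} J (rowSums , _) = trans (map-planPairs J proj₁)
  (cong concat (map-cong (λ i → trans (concatMap-replicate (J i) (toℕ i) (allFin n))
                                      (cong (λ k → replicate k (toℕ i)) (rowSums i))) (allFin n)))

map-proj₂-planPairs : ∀ {n} {α β : Comp n} J → Transport α β J → map proj₂ (planPairs J) ↭ word β
map-proj₂-planPairs {n} {β = β} J (_ , colSums) = begin
  map proj₂ (planPairs J)
    ≡⟨ map-planPairs J proj₂ ⟩
  concatMap (λ i → concatMap (λ j → replicate (J i j) (toℕ j)) (allFin n)) (allFin n)
    ↭⟨ concatMap-comm-↭ (λ i j → replicate (J i j) (toℕ j)) (allFin n) (allFin n) ⟩
  concatMap (λ j → concatMap (λ i → replicate (J i j) (toℕ j)) (allFin n)) (allFin n)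
    ≡⟨ cong concat (map-cong column (allFin n)) ⟩
  concatMap (λ j → replicate (β j) (toℕ j)) (allFin n) ∎
  where
  open PermutationReasoning
  column : ∀ j → concatMap (λ i → replicate (J i j) (toℕ j)) (allFin n) ≡ replicate (β j) (toℕ j)
  column j = trans (concatMap-replicate (λ i → J i j) (toℕ j) (allFin n))
                   (cong (λ k → replicate k (toℕ j)) (colSums j))

matchingCost-≤-cost : ∀ {n} (α β : Comp n) J → Transport α β J → matchingCost (word α) (word β) ≤ cost J
matchingCost-≤-cost α β J plan = begin
  matchingCost (word α) (word β)   ≡⟨ cong (matchingCost (word α)) sort≡ ⟨
  matchingCost (word α) (sort zs)  ≤⟨ matchingCost-sort zs (word-sorted α) length≡ ⟩
  matchingCost (word α) zs         ≡⟨ cong (λ xs → matchingCost xs zs) fst≡ ⟨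
  matchingCost (map proj₁ P) zs    ≡⟨ sum-dist≡matchingCost P ⟨
  sum (map dist P)                 ≡⟨ sum-dist-planPairs J ⟩
  cost J                           ∎
  where
  open ≤-Reasoning
  P  = planPairs J
  zs = map proj₂ P
  fst≡ : map proj₁ P ≡ word α
  fst≡ = map-proj₁-planPairs J plan
  sort≡ : sort zs ≡ word β
  sort≡ = Pointwise-≡⇒≡ (↗↭↗⇒≋ ≤-totalOrder (sort-↗ zs) (word-sorted β)
                          (↭⇒↭ₛ (↭-trans (sort-↭ zs) (map-proj₂-planPairs J plan))))
  length≡ : length (word α) ≡ length zs
  length≡ = trans (cong length (sym fst≡)) (trans (length-map proj₁ P) (sym (length-map proj₂ P)))

corollary1 : (s n : ℕ) → s ≥ 1 → n ≥ 1 → (α β : Comp n) → InC s n α → InC s n β →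
    IsEMC α β (symDiffSize s n α β)
corollary1 s n _ _ α β α∈C β∈C rewrite symDiffSize≡matchingCost α β α∈C β∈C =
  sortedPlan α β (trans α∈C (sym β∈C)) , matchingCost-≤-cost α β
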